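{- The dodecahedron graph $G(10,2)$ is a monoid graph.
   Context: $G(n,k)$ ($0<k<n/2$) has vertices $u_0,\dots,u_{n-1},v_0,\dots,v_{n-1}$ and edges $u_iu_{i+1}$, $v_iv_{i+k}$, $u_iv_i$ (indices mod $n$). For a semigroup $S$ and $C\subseteq S$, the Cayley graph $\mathrm{Cay}(S,C)$ is the directed multigraph (loops allowed) with vertex set $S$ and one arc $(s,sc)$ for each $s\in S$, $c\in C$; its underlying graph is obtained by deleting loops, forgetting orientations and merging parallel edges. A graph is a monoid graph if it is isomorphic to the underlying graph of $\mathrm{Cay}(M,C)$ for some monoid $M$ and some $C\subseteq M$. -}

module Defs where

open import Level using (0ℓ)
open import Data.Nat using (ℕ; _+_; NonZero)
open import Data.Nat.DivMod using (_%_)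
open import Data.Fin using (Fin; toℕ)
open import Data.Sum using (_⊎_; inj₁; inj₂)
open import Data.Product using (Σ; _×_; ∃)
open import Data.Empty using (⊥)
open import Relation.Nullary using (¬_)
open import Relation.Binary.PropositionalEquality using (_≡_)
open import Algebra.Core using (Op₂)
open import Algebra.Structures using (IsMonoid)
open import Function.Bundles using (_⤖_; _⇔_; Bijection)

record Graph : Set₁ where
  field
    V   : Set
    Adj : V → V → Set
open Graph public

-- Directed "generating" edges of G(n,k) on vertices u_i = inj₁ i, v_i = inj₂ i:
--   u_i u_{i+1},  v_i v_{i+k},  u_i v_i   (indices mod n)
data GPArc (n k : ℕ) .{{_ : NonZero n}} : Fin n ⊎ Fin n → Fin n ⊎ Fin n → Set where
  outer : ∀ i j → toℕ j ≡ (toℕ i + 1) % n → GPArc n k (inj₁ i) (inj₁ j)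
  inner : ∀ i j → toℕ j ≡ (toℕ i + k) % n → GPArc n k (inj₂ i) (inj₂ j)
  spoke : ∀ i → GPArc n k (inj₁ i) (inj₂ i)

GP : (n k : ℕ) .{{_ : NonZero n}} → Graph
GP n k = record
  { V   = Fin n ⊎ Fin n
  ; Adj = λ x y → GPArc n k x y ⊎ GPArc n k y x }

-- Underlying graph of Cay(M, C) for a monoid (M, ∙, ε) and C ⊆ M:
-- loops deleted, orientations forgotten, parallel edges merged.
CayUnderlying : (M : Set) → Op₂ M → (M → Set) → Graph
CayUnderlying M _∙_ C = record
  { V   = M
  ; Adj = λ x y → ¬ (x ≡ y) × ∃ λ c → C c × ((y ≡ x ∙ c) ⊎ (x ≡ y ∙ c)) }

_≅_ : Graph → Graph → Set
G ≅ H = Σ (V G ⤖ V H) λ f →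
  ∀ x y → Adj G x y ⇔ Adj H (Bijection.to f x) (Bijection.to f y)

IsMonoidGraph : Graph → Set₁
IsMonoidGraph G =
  Σ Set λ M → Σ (Op₂ M) λ _∙_ → Σ M λ ε →
  IsMonoid {A = M} _≡_ _∙_ ε × Σ (M → Set) λ C → G ≅ CayUnderlying M _∙_ C

{-# OPTIONS --safe #-}

-- Label the elements of a 20-element monoid M by the vertices u₀ … u₉, v₀ … v₉
-- of G(10,2), with identity u₀, via the multiplication table below.  The arcs
-- x → x ∙ c for c ∈ {u₁, u₉, v₀}, after deleting loops and forgetting
-- orientations, are exactly the edges of G(10,2), so the identity labelling is
-- an isomorphism onto the underlying graph of Cay(M, {u₁, u₉, v₀}).  Both the
-- monoid laws and this agreement of adjacency are finite decidable statements,
-- checked by exhaustive evaluation.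
module Submission where

open import Defs
open import Agda.Builtin.FromNat using (Number; fromNat)
open import Data.Nat using (ℕ; _+_; _≟_; NonZero)
import Data.Nat.Literals as ℕ
open import Data.Nat.DivMod using (_%_)
open import Data.Fin using (Fin; toℕ; join)
import Data.Fin.Literals as Fin
import Data.Fin.Properties as Fin
open import Data.Vec using (Vec; _∷_; []; lookup)
open import Data.List using (List; _∷_; [])
open import Data.List.Membership.Propositional using (_∈_; find)
open import Data.List.Membership.Propositional.Properties.Core using (∃∈-Any)
open import Data.List.Relation.Unary.Any using (any?)
open import Data.Sum using (_⊎_; inj₁; inj₂)
import Data.Sum.Properties as Sum
open import Data.Product using (_,_)
import Data.Bool.Properties as Bool
open import Data.Unit using (tt)
open import Data.Empty using (⊥-elim)
open import Relation.Nullary using (Dec; yes; no; ¬?; _×-dec_; _⊎-dec_)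
open import Relation.Nullary.Decidable using (does; toWitness; map′)
open import Relation.Binary using (DecidableEquality)
open import Relation.Binary.PropositionalEquality using (_≡_; refl)
open import Relation.Binary.PropositionalEquality.Algebra using (isMagma)
open import Algebra.Core using (Op₂)
open import Algebra.Structures using (IsMonoid)
open import Function.Bundles using (_⇔_; mk⇔)
open import Function.Construct.Identity using (⤖-id)

instance
  ℕ-literals : Number ℕ
  ℕ-literals = ℕ.number

  Fin-literals : ∀ {n} → Number (Fin n)
  Fin-literals {n} = Fin.number n

⇔-of-does-≡ : {A B : Set} (a? : Dec A) (b? : Dec B) → does a? ≡ does b? → A ⇔ B
⇔-of-does-≡ (yes a) (yes b) _ = mk⇔ (λ _ → b) (λ _ → a)
⇔-of-does-≡ (no ¬a) (no ¬b) _ = mk⇔ (λ a → ⊥-elim (¬a a)) (λ b → ⊥-elim (¬b b))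
⇔-of-does-≡ (yes _) (no _) ()
⇔-of-does-≡ (no _) (yes _) ()

all-⊎? : {A B : Set} {P : A ⊎ B → Set} →
         Dec (∀ a → P (inj₁ a)) → Dec (∀ b → P (inj₂ b)) → Dec (∀ x → P x)
all-⊎? (yes p₁) (yes p₂) = yes λ { (inj₁ a) → p₁ a ; (inj₂ b) → p₂ b }
all-⊎? (no ¬p₁) _        = no λ p → ¬p₁ (λ a → p (inj₁ a))
all-⊎? (yes _)  (no ¬p₂) = no λ p → ¬p₂ (λ b → p (inj₂ b))

GPArc? : ∀ n k .{{_ : NonZero n}} x y → Dec (GPArc n k x y)
GPArc? n k (inj₁ i) (inj₁ j) with toℕ j ≟ (toℕ i + 1) % n
... | yes eq = yes (outer i j eq)
... | no ¬eq = no λ { (outer _ _ eq) → ¬eq eq }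
GPArc? n k (inj₂ i) (inj₂ j) with toℕ j ≟ (toℕ i + k) % n
... | yes eq = yes (inner i j eq)
... | no ¬eq = no λ { (inner _ _ eq) → ¬eq eq }
GPArc? n k (inj₁ i) (inj₂ j) with i Fin.≟ j
... | yes refl = yes (spoke i)
... | no i≢j   = no λ { (spoke _) → i≢j refl }
GPArc? n k (inj₂ i) (inj₁ j) = no λ ()

GP-Adj? : ∀ n k .{{_ : NonZero n}} x y → Dec (Adj (GP n k) x y)
GP-Adj? n k x y = GPArc? n k x y ⊎-dec GPArc? n k y x

CayUnderlying-Adj? : {M : Set} → DecidableEquality M → (_∙_ : Op₂ M) (cs : List M) →
                     ∀ x y → Dec (Adj (CayUnderlying M _∙_ (_∈ cs)) x y)
CayUnderlying-Adj? _≟ᴹ_ _∙_ cs x y =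
  ¬? (x ≟ᴹ y) ×-dec map′ find ∃∈-Any (any? (λ c → (y ≟ᴹ (x ∙ c)) ⊎-dec (x ≟ᴹ (y ∙ c))) cs)

M : Set
M = Fin 10 ⊎ Fin 10

u v : Fin 10 → M
u = inj₁
v = inj₂

-- Row x, column y holds x ∙ y; rows and columns are ordered u₀ … u₉, v₀ … v₉.
table : Vec (Vec M 20) 20
table =
  (u 0 ∷ u 1 ∷ u 2 ∷ u 3 ∷ u 4 ∷ u 5 ∷ u 6 ∷ u 7 ∷ u 8 ∷ u 9 ∷ v 0 ∷ v 1 ∷ v 2 ∷ v 3 ∷ v 4 ∷ v 5 ∷ v 6 ∷ v 7 ∷ v 8 ∷ v 9 ∷ [])
  ∷ (u 1 ∷ u 0 ∷ u 9 ∷ u 8 ∷ u 7 ∷ u 6 ∷ u 5 ∷ u 4 ∷ u 3 ∷ u 2 ∷ v 1 ∷ v 0 ∷ v 9 ∷ v 8 ∷ v 7 ∷ v 6 ∷ v 5 ∷ v 4 ∷ v 3 ∷ v 2 ∷ [])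
  ∷ (u 2 ∷ u 2 ∷ u 3 ∷ u 3 ∷ u 3 ∷ u 2 ∷ u 2 ∷ u 3 ∷ u 3 ∷ u 3 ∷ u 2 ∷ u 2 ∷ u 2 ∷ u 3 ∷ u 2 ∷ u 2 ∷ u 2 ∷ u 2 ∷ u 3 ∷ u 2 ∷ [])
  ∷ (u 3 ∷ u 3 ∷ u 3 ∷ u 3 ∷ u 3 ∷ u 3 ∷ u 3 ∷ u 3 ∷ u 3 ∷ u 3 ∷ u 3 ∷ u 3 ∷ u 3 ∷ u 3 ∷ u 3 ∷ u 3 ∷ u 3 ∷ u 3 ∷ u 3 ∷ u 3 ∷ [])
  ∷ (u 4 ∷ u 4 ∷ u 3 ∷ u 3 ∷ u 3 ∷ u 4 ∷ u 4 ∷ u 3 ∷ u 3 ∷ u 3 ∷ u 4 ∷ u 4 ∷ u 4 ∷ u 3 ∷ u 4 ∷ u 4 ∷ u 4 ∷ u 4 ∷ u 3 ∷ u 4 ∷ [])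
  ∷ (u 5 ∷ u 6 ∷ u 7 ∷ u 8 ∷ u 7 ∷ u 6 ∷ u 5 ∷ u 4 ∷ u 3 ∷ u 4 ∷ u 5 ∷ u 6 ∷ u 6 ∷ u 7 ∷ u 6 ∷ u 6 ∷ u 5 ∷ u 5 ∷ u 4 ∷ u 5 ∷ [])
  ∷ (u 6 ∷ u 5 ∷ u 4 ∷ u 3 ∷ u 4 ∷ u 5 ∷ u 6 ∷ u 7 ∷ u 8 ∷ u 7 ∷ u 6 ∷ u 5 ∷ u 5 ∷ u 4 ∷ u 5 ∷ u 5 ∷ u 6 ∷ u 6 ∷ u 7 ∷ u 6 ∷ [])
  ∷ (u 7 ∷ u 7 ∷ u 8 ∷ u 8 ∷ u 8 ∷ u 7 ∷ u 7 ∷ u 8 ∷ u 8 ∷ u 8 ∷ u 7 ∷ u 7 ∷ u 7 ∷ u 8 ∷ u 7 ∷ u 7 ∷ u 7 ∷ u 7 ∷ u 8 ∷ u 7 ∷ [])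
  ∷ (u 8 ∷ u 8 ∷ u 8 ∷ u 8 ∷ u 8 ∷ u 8 ∷ u 8 ∷ u 8 ∷ u 8 ∷ u 8 ∷ u 8 ∷ u 8 ∷ u 8 ∷ u 8 ∷ u 8 ∷ u 8 ∷ u 8 ∷ u 8 ∷ u 8 ∷ u 8 ∷ [])
  ∷ (u 9 ∷ u 9 ∷ u 8 ∷ u 8 ∷ u 8 ∷ u 9 ∷ u 9 ∷ u 8 ∷ u 8 ∷ u 8 ∷ u 9 ∷ u 9 ∷ u 9 ∷ u 8 ∷ u 9 ∷ u 9 ∷ u 9 ∷ u 9 ∷ u 8 ∷ u 9 ∷ [])
  ∷ (v 0 ∷ v 2 ∷ u 2 ∷ u 3 ∷ u 4 ∷ u 5 ∷ u 6 ∷ u 7 ∷ u 8 ∷ v 8 ∷ v 0 ∷ v 4 ∷ v 2 ∷ u 4 ∷ v 4 ∷ u 5 ∷ v 6 ∷ u 6 ∷ v 8 ∷ v 6 ∷ [])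
  ∷ (v 1 ∷ v 9 ∷ u 9 ∷ u 8 ∷ u 7 ∷ u 6 ∷ u 5 ∷ u 4 ∷ u 3 ∷ v 3 ∷ v 1 ∷ v 7 ∷ v 9 ∷ u 7 ∷ v 7 ∷ u 6 ∷ v 5 ∷ u 5 ∷ v 3 ∷ v 5 ∷ [])
  ∷ (v 2 ∷ v 0 ∷ v 8 ∷ u 8 ∷ u 7 ∷ u 6 ∷ u 5 ∷ u 4 ∷ u 3 ∷ u 2 ∷ v 4 ∷ v 0 ∷ v 6 ∷ v 8 ∷ u 6 ∷ v 6 ∷ u 5 ∷ v 4 ∷ u 4 ∷ v 2 ∷ [])
  ∷ (v 3 ∷ v 3 ∷ u 3 ∷ u 3 ∷ u 3 ∷ v 3 ∷ v 3 ∷ u 3 ∷ u 3 ∷ u 3 ∷ v 3 ∷ v 3 ∷ v 3 ∷ u 3 ∷ v 3 ∷ v 3 ∷ v 3 ∷ v 3 ∷ u 3 ∷ v 3 ∷ [])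
  ∷ (v 4 ∷ v 6 ∷ v 8 ∷ u 8 ∷ u 7 ∷ u 6 ∷ u 5 ∷ u 4 ∷ u 3 ∷ u 4 ∷ v 4 ∷ u 6 ∷ v 6 ∷ u 7 ∷ u 6 ∷ u 6 ∷ u 5 ∷ u 5 ∷ u 4 ∷ u 5 ∷ [])
  ∷ (v 5 ∷ v 7 ∷ u 7 ∷ u 8 ∷ u 7 ∷ u 6 ∷ u 5 ∷ u 4 ∷ u 3 ∷ v 3 ∷ u 5 ∷ v 7 ∷ u 6 ∷ u 7 ∷ u 6 ∷ u 6 ∷ u 5 ∷ u 5 ∷ u 4 ∷ v 5 ∷ [])
  ∷ (v 6 ∷ v 4 ∷ u 4 ∷ u 3 ∷ u 4 ∷ u 5 ∷ u 6 ∷ u 7 ∷ u 8 ∷ v 8 ∷ u 6 ∷ v 4 ∷ u 5 ∷ u 4 ∷ u 5 ∷ u 5 ∷ u 6 ∷ u 6 ∷ u 7 ∷ v 6 ∷ [])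
  ∷ (v 7 ∷ v 5 ∷ v 3 ∷ u 3 ∷ u 4 ∷ u 5 ∷ u 6 ∷ u 7 ∷ u 8 ∷ u 7 ∷ v 7 ∷ u 5 ∷ v 5 ∷ u 4 ∷ u 5 ∷ u 5 ∷ u 6 ∷ u 6 ∷ u 7 ∷ u 6 ∷ [])
  ∷ (v 8 ∷ v 8 ∷ u 8 ∷ u 8 ∷ u 8 ∷ v 8 ∷ v 8 ∷ u 8 ∷ u 8 ∷ u 8 ∷ v 8 ∷ v 8 ∷ v 8 ∷ u 8 ∷ v 8 ∷ v 8 ∷ v 8 ∷ v 8 ∷ u 8 ∷ v 8 ∷ [])
  ∷ (v 9 ∷ v 1 ∷ v 3 ∷ u 3 ∷ u 4 ∷ u 5 ∷ u 6 ∷ u 7 ∷ u 8 ∷ u 9 ∷ v 7 ∷ v 1 ∷ v 5 ∷ v 3 ∷ u 5 ∷ v 5 ∷ u 6 ∷ v 7 ∷ u 7 ∷ v 9 ∷ [])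
  ∷ []

_∙_ : Op₂ M
x ∙ y = lookup (lookup table (join 10 10 x)) (join 10 10 y)

_≟ᴹ_ : DecidableEquality M
_≟ᴹ_ = Sum.≡-dec Fin._≟_ Fin._≟_

all-M? : {P : M → Set} → (∀ x → Dec (P x)) → Dec (∀ x → P x)
all-M? P? = all-⊎? (Fin.all? (λ i → P? (u i))) (Fin.all? (λ i → P? (v i)))

∙-isMonoid : IsMonoid _≡_ _∙_ (u 0)
∙-isMonoid = record
  { isSemigroup = record
    { isMagma = isMagma _∙_
    ; assoc   = toWitness {a? = all-M? λ x → all-M? λ y → all-M? λ z →
                                  ((x ∙ y) ∙ z) ≟ᴹ (x ∙ (y ∙ z))} tt
    }
  ; identity = toWitness {a? = all-M? λ x → (u 0 ∙ x) ≟ᴹ x} tt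
             , toWitness {a? = all-M? λ x → (x ∙ u 0) ≟ᴹ x} tt
  }

generators : List M
generators = u 1 ∷ u 9 ∷ v 0 ∷ []

Dodecahedron-Adj? : ∀ x y → Dec (Adj (GP 10 2) x y)
Dodecahedron-Adj? = GP-Adj? 10 2

Cayley-Adj? : ∀ x y → Dec (Adj (CayUnderlying M _∙_ (_∈ generators)) x y)
Cayley-Adj? = CayUnderlying-Adj? _≟ᴹ_ _∙_ generators

adjacency-agrees : ∀ x y → does (Dodecahedron-Adj? x y) ≡ does (Cayley-Adj? x y)
adjacency-agrees = toWitness
  {a? = all-M? λ x → all-M? λ y → does (Dodecahedron-Adj? x y) Bool.≟ does (Cayley-Adj? x y)} tt

proposition3p9 : IsMonoidGraph (GP 10 2)
proposition3p9 =
  M , _∙_ , u 0 , ∙-isMonoid , (_∈ generators) , ⤖-id M ,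
  λ x y → ⇔-of-does-≡ (Dodecahedron-Adj? x y) (Cayley-Adj? x y) (adjacency-agrees x y)
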